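{- Let $n$ be a positive integer, $r\ge 0$ an integer, and $C_2=\mathrm{Circ}(\mathbb{F}_0^{(r)},\mathbb{F}_1^{(r)},\ldots,\mathbb{F}_{n-1}^{(r)})$. Then \[ \mathbb{F}_{n-1}^{(r+1)}\le \|C_2\|_E\le \sqrt{n}\,\mathbb{F}_{n-1}^{(r+1)}. \]
   Context: $F_n$ denotes the Fibonacci numbers: $F_0=0$, $F_1=1$, $F_{n+2}=F_{n+1}+F_n$. The hyperharmonic Fibonacci numbers are defined by $\mathbb{F}_{n}^{(0)}=\frac{1}{F_{n}}$ for $n\ge1$, $\mathbb{F}_0^{(k)}=0$ for all $k\ge 0$, and $\mathbb{F}_{n}^{(r)}=\sum_{k=1}^{n}\mathbb{F}_{k}^{(r-1)}$ for $n,r\ge 1$. $\mathrm{Circ}(c_0,\ldots,c_{n-1})$ is the $n\times n$ circulant matrix whose $(i,j)$ entry is $c_{(j-i)\bmod n}$. $\|A\|_E=\big(\sum_{i,j}|a_{ij}|^2\big)^{1/2}$ is the Euclidean (Frobenius) norm. -}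

module Defs where

open import Data.Nat as ℕ using (ℕ; zero; suc; _∸_; _%_; NonZero)
open import Data.Fin using (Fin; toℕ) renaming (zero to fzero; suc to fsuc)
open import Data.Integer using (+_)
open import Data.Rational using (ℚ; 0ℚ; _+_; _*_; _/_)

fib : ℕ → ℕ
fib zero = 0
fib (suc zero) = 1
fib (suc (suc n)) = fib (suc n) ℕ.+ fib n

fib-suc-nonZero : ∀ n → NonZero (fib (suc n))
fib-suc-nonZero zero = _
fib-suc-nonZero (suc n) with fib (suc n) | fib-suc-nonZero n
... | suc k | _ = _

-- hyperharmonic Fibonacci numbers: hypFib r n = 𝔽_n^{(r)}
hypFib : ℕ → ℕ → ℚ
hypFib zero zero = 0ℚ
hypFib zero (suc n) = _/_ (+ 1) (fib (suc n)) {{fib-suc-nonZero n}}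
hypFib (suc r) zero = 0ℚ
hypFib (suc r) (suc n) = hypFib (suc r) n + hypFib r (suc n)

ℕtoℚ : ℕ → ℚ
ℕtoℚ k = + k / 1

sumFin : (n : ℕ) → (Fin n → ℚ) → ℚ
sumFin zero f = 0ℚ
sumFin (suc n) f = f fzero + sumFin n (λ i → f (fsuc i))


-- Circ(c_0,…,c_{n-1}): (i,j) entry is c_{(j-i) mod n}
circ : (n : ℕ) → .{{_ : NonZero n}} → (ℕ → ℚ) → Fin n → Fin n → ℚ
circ n c i j = c (((toℕ j ℕ.+ n) ∸ toℕ i) % n)

frobNormSq : (n : ℕ) → (Fin n → Fin n → ℚ) → ℚ
frobNormSq n A = sumFin n (λ i → sumFin n (λ j → A i j * A i j))

{-# OPTIONS --safe #-}
-- Every row of a circulant matrix is a cyclic rearrangement of its first row, so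
-- ‖Circ(c₀,…,c_{n-1})‖²_E = n Σ_{k<n} c_k².  Cauchy–Schwarz gives (Σ c_k)² ≤ n Σ c_k², and
-- for nonnegative c_k the cross terms give Σ c_k² ≤ (Σ c_k)².  With c_k = 𝔽_k^{(r)} ≥ 0 the
-- sum Σ_{k≤m} c_k is 𝔽_m^{(r+1)}, which yields both bounds, squared.
module Submission where

open import Defs
open import Data.Nat using (ℕ; suc)
open import Data.Product using (_×_; _,_)
open import Data.Rational using (_≤_; _*_)

open import Data.Nat as ℕ using (zero; NonZero; _%_; _∸_)
import Data.Nat.Properties as ℕ
open import Data.Nat.DivMod using ([m+n]%n≡m%n; m<n⇒m%n≡m)
open import Data.Nat.Coprimality using (1-coprimeTo) renaming (sym to coprime-sym)
open import Data.Fin using (Fin; toℕ) renaming (zero to fzero; suc to fsuc)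
open import Data.Fin.Properties using (toℕ<n)
import Data.Integer as ℤ
import Data.Integer.Tactic.RingSolver as ℤ-Solver
open import Data.Rational using (ℚ; mkℚ; 0ℚ; 1ℚ; _+_; -_; _-_; nonNegative; nonPositive)
open import Data.Rational.Properties
import Data.Rational.Unnormalised as ℚᵘ
import Data.Rational.Unnormalised.Properties as ℚᵘ
open import Data.Rational.Solver using (module +-*-Solver)
open +-*-Solver
open import Data.Sum using (inj₁; inj₂)
open import Relation.Binary.PropositionalEquality

ℕtoℚ≡mkℚ : ∀ n → ℕtoℚ n ≡ mkℚ (ℤ.+ n) 0 (coprime-sym (1-coprimeTo n))
ℕtoℚ≡mkℚ n = normalize-coprime _

ℕtoℚ-suc : ∀ n → ℕtoℚ (suc n) ≡ ℕtoℚ n + 1ℚ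
ℕtoℚ-suc n rewrite ℕtoℚ≡mkℚ n | ℕtoℚ≡mkℚ (suc n) =
  toℚᵘ-injective (ℚᵘ.≃-trans (ℚᵘ.*≡* ([1+x]*1≡[x*1+1*1]*1 (ℤ.+ n))) (ℚᵘ.≃-sym (toℚᵘ-homo-+ n/1 1ℚ)))
  where
  n/1 : ℚ
  n/1 = mkℚ (ℤ.+ n) 0 (coprime-sym (1-coprimeTo n))
  [1+x]*1≡[x*1+1*1]*1 : ∀ x → (ℤ.+ 1 ℤ.+ x) ℤ.* ℤ.+ 1 ≡ (x ℤ.* ℤ.+ 1 ℤ.+ ℤ.+ 1 ℤ.* ℤ.+ 1) ℤ.* ℤ.+ 1
  [1+x]*1≡[x*1+1*1]*1 = ℤ-Solver.solve-∀

square-nonNeg : ∀ p → 0ℚ ≤ p * p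
square-nonNeg p with ≤-total 0ℚ p
... | inj₁ 0≤p = nonNegative⁻¹ _ {{nonNeg*nonNeg⇒nonNeg p {{nonNegative 0≤p}} p {{nonNegative 0≤p}}}}
... | inj₂ p≤0 = nonNegative⁻¹ _ {{nonPos*nonPos⇒nonPos p {{nonPositive p≤0}} p {{nonPositive p≤0}}}}

p*q+p*q≤p*p+q*q : ∀ p q → p * q + p * q ≤ p * p + q * q
p*q+p*q≤p*p+q*q p q = begin
  p * q + p * q                  ≡⟨ sym (+-identityˡ _) ⟩
  0ℚ + (p * q + p * q)           ≤⟨ +-monoˡ-≤ _ (square-nonNeg (p - q)) ⟩
  (p - q) * (p - q) + (p * q + p * q)
    ≡⟨ solve 2 (λ p q → (p :- q) :* (p :- q) :+ (p :* q :+ p :* q) := p :* p :+ q :* q) refl p q ⟩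
  p * p + q * q                  ∎
  where open ≤-Reasoning

sumBelow : ℕ → (ℕ → ℚ) → ℚ
sumBelow zero    f = 0ℚ
sumBelow (suc n) f = sumBelow n f + f n

sumSquares : ℕ → (ℕ → ℚ) → ℚ
sumSquares n c = sumBelow n (λ k → c k * c k)

sumBelow-cong : ∀ n {f g : ℕ → ℚ} → (∀ k → k ℕ.< n → f k ≡ g k) → sumBelow n f ≡ sumBelow n g
sumBelow-cong zero    f≡g = refl
sumBelow-cong (suc n) f≡g =
  cong₂ _+_ (sumBelow-cong n (λ k k<n → f≡g k (ℕ.m<n⇒m<1+n k<n))) (f≡g n (ℕ.n<1+n n))

sumBelow-suc-head : ∀ n (f : ℕ → ℚ) → sumBelow (suc n) f ≡ f 0 + sumBelow n (λ k → f (suc k))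
sumBelow-suc-head zero    f = +-comm 0ℚ (f 0)
sumBelow-suc-head (suc n) f = trans (cong (_+ f (suc n)) (sumBelow-suc-head n f)) (+-assoc (f 0) _ _)

sumBelow-nonNeg : ∀ n (f : ℕ → ℚ) → (∀ k → 0ℚ ≤ f k) → 0ℚ ≤ sumBelow n f
sumBelow-nonNeg zero    f f≥0 = ≤-refl
sumBelow-nonNeg (suc n) f f≥0 = +-mono-≤ (sumBelow-nonNeg n f f≥0) (f≥0 n)

sumFin-toℕ : ∀ n (f : ℕ → ℚ) → sumFin n (λ i → f (toℕ i)) ≡ sumBelow n f
sumFin-toℕ zero    f = refl
sumFin-toℕ (suc n) f =
  trans (cong (f 0 +_) (sumFin-toℕ n (λ k → f (suc k)))) (sym (sumBelow-suc-head n f))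

sumFin-const : ∀ n (f : Fin n → ℚ) x → (∀ i → f i ≡ x) → sumFin n f ≡ ℕtoℚ n * x
sumFin-const zero    f x f≡x = sym (*-zeroˡ x)
sumFin-const (suc n) f x f≡x = begin
  f fzero + sumFin n (λ i → f (fsuc i))  ≡⟨ cong₂ _+_ (f≡x fzero) (sumFin-const n _ x (λ i → f≡x (fsuc i))) ⟩
  x + ℕtoℚ n * x                         ≡⟨ solve 2 (λ x n → x :+ n :* x := (n :+ con 1ℚ) :* x) refl x (ℕtoℚ n) ⟩
  (ℕtoℚ n + 1ℚ) * x                      ≡⟨ cong (_* x) (sym (ℕtoℚ-suc n)) ⟩
  ℕtoℚ (suc n) * x                       ∎
  where open ≡-Reasoning

sumBelow-rotate : ∀ n (f : ℕ → ℚ) → f n ≡ f 0 → sumBelow n (λ k → f (suc k)) ≡ sumBelow n f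
sumBelow-rotate n f fn≡f0 = begin
  T                    ≡⟨ solve 2 (λ a t → t := (:- a) :+ (a :+ t)) refl (f 0) T ⟩
  - f 0 + (f 0 + T)    ≡⟨ cong (- f 0 +_) (sym (sumBelow-suc-head n f)) ⟩
  - f 0 + (S + f n)    ≡⟨ cong (λ z → - f 0 + (S + z)) fn≡f0 ⟩
  - f 0 + (S + f 0)    ≡⟨ solve 2 (λ a s → (:- a) :+ (s :+ a) := s) refl (f 0) S ⟩
  S                    ∎
  where
  open ≡-Reasoning
  T = sumBelow n (λ k → f (suc k))
  S = sumBelow n f

sumBelow-shift-periodic : ∀ n (f : ℕ → ℚ) → (∀ k → f (k ℕ.+ n) ≡ f k) →
                          ∀ t → sumBelow n (λ k → f (k ℕ.+ t)) ≡ sumBelow n f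
sumBelow-shift-periodic n f periodic zero =
  sumBelow-cong n (λ k _ → cong f (ℕ.+-identityʳ k))
sumBelow-shift-periodic n f periodic (suc t) = begin
  sumBelow n (λ k → f (k ℕ.+ suc t))    ≡⟨ sumBelow-cong n (λ k _ → cong f (ℕ.+-suc k t)) ⟩
  sumBelow n (λ k → f (suc k ℕ.+ t))    ≡⟨ sumBelow-rotate n (λ k → f (k ℕ.+ t)) (trans (cong f (ℕ.+-comm n t)) (periodic t)) ⟩
  sumBelow n (λ k → f (k ℕ.+ t))        ≡⟨ sumBelow-shift-periodic n f periodic t ⟩
  sumBelow n f                          ∎
  where open ≡-Reasoning

circ-row-sumSquares : ∀ n .{{_ : NonZero n}} (c : ℕ → ℚ) (i : Fin n) →
                      sumFin n (λ j → circ n c i j * circ n c i j) ≡ sumSquares n c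
circ-row-sumSquares n c i = begin
  sumFin n (λ j → g ((toℕ j ℕ.+ n) ∸ toℕ i))  ≡⟨ sumFin-toℕ n (λ k → g ((k ℕ.+ n) ∸ toℕ i)) ⟩
  sumBelow n (λ k → g ((k ℕ.+ n) ∸ toℕ i))    ≡⟨ sumBelow-cong n (λ k _ → cong g (ℕ.+-∸-assoc k (ℕ.<⇒≤ (toℕ<n i)))) ⟩
  sumBelow n (λ k → g (k ℕ.+ (n ∸ toℕ i)))    ≡⟨ sumBelow-shift-periodic n g (λ k → cong (λ z → c z * c z) ([m+n]%n≡m%n k n)) (n ∸ toℕ i) ⟩
  sumBelow n g                                ≡⟨ sumBelow-cong n (λ k k<n → cong (λ z → c z * c z) (m<n⇒m%n≡m k<n)) ⟩
  sumSquares n c                              ∎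
  where
  open ≡-Reasoning
  g : ℕ → ℚ
  g k = c (k % n) * c (k % n)

frobNormSq-circ : ∀ n .{{_ : NonZero n}} (c : ℕ → ℚ) →
                  frobNormSq n (circ n c) ≡ ℕtoℚ n * sumSquares n c
frobNormSq-circ n c = sumFin-const n _ _ (circ-row-sumSquares n c)

sum*x+sum*x≤sumSquares+n*x*x : ∀ n (c : ℕ → ℚ) x →
  sumBelow n c * x + sumBelow n c * x ≤ sumSquares n c + ℕtoℚ n * (x * x)
sum*x+sum*x≤sumSquares+n*x*x zero c x =
  ≤-reflexive (solve 1 (λ x → con 0ℚ :* x :+ con 0ℚ :* x := con 0ℚ :+ con 0ℚ :* (x :* x)) refl x)
sum*x+sum*x≤sumSquares+n*x*x (suc n) c x = begin
  (S + c n) * x + (S + c n) * x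
    ≡⟨ solve 3 (λ s a x → (s :+ a) :* x :+ (s :+ a) :* x := (s :* x :+ s :* x) :+ (a :* x :+ a :* x)) refl S (c n) x ⟩
  (S * x + S * x) + (c n * x + c n * x)
    ≤⟨ +-mono-≤ (sum*x+sum*x≤sumSquares+n*x*x n c x) (p*q+p*q≤p*p+q*q (c n) x) ⟩
  (Q + ℕtoℚ n * (x * x)) + (c n * c n + x * x)
    ≡⟨ solve 4 (λ q n a x → (q :+ n :* (x :* x)) :+ (a :* a :+ x :* x) := (q :+ a :* a) :+ (n :+ con 1ℚ) :* (x :* x)) refl Q (ℕtoℚ n) (c n) x ⟩
  (Q + c n * c n) + (ℕtoℚ n + 1ℚ) * (x * x)
    ≡⟨ cong (λ z → (Q + c n * c n) + z * (x * x)) (sym (ℕtoℚ-suc n)) ⟩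
  (Q + c n * c n) + ℕtoℚ (suc n) * (x * x) ∎
  where
  open ≤-Reasoning
  S = sumBelow n c
  Q = sumSquares n c

cauchy-schwarz : ∀ n (c : ℕ → ℚ) → sumBelow n c * sumBelow n c ≤ ℕtoℚ n * sumSquares n c
cauchy-schwarz zero c = ≤-reflexive (solve 0 (con 0ℚ :* con 0ℚ := con 0ℚ :* con 0ℚ) refl)
cauchy-schwarz (suc n) c = begin
  (S + c n) * (S + c n)
    ≡⟨ solve 2 (λ s a → (s :+ a) :* (s :+ a) := s :* s :+ (s :* a :+ s :* a) :+ a :* a) refl S (c n) ⟩
  S * S + (S * c n + S * c n) + c n * c n
    ≤⟨ +-monoˡ-≤ (c n * c n) (+-mono-≤ (cauchy-schwarz n c) (sum*x+sum*x≤sumSquares+n*x*x n c (c n))) ⟩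
  ℕtoℚ n * Q + (Q + ℕtoℚ n * (c n * c n)) + c n * c n
    ≡⟨ solve 3 (λ n q a → n :* q :+ (q :+ n :* (a :* a)) :+ a :* a := (n :+ con 1ℚ) :* (q :+ a :* a)) refl (ℕtoℚ n) Q (c n) ⟩
  (ℕtoℚ n + 1ℚ) * (Q + c n * c n)
    ≡⟨ cong (_* (Q + c n * c n)) (sym (ℕtoℚ-suc n)) ⟩
  ℕtoℚ (suc n) * (Q + c n * c n) ∎
  where
  open ≤-Reasoning
  S = sumBelow n c
  Q = sumSquares n c

sumSquares≤sum*sum : ∀ n (c : ℕ → ℚ) → (∀ k → 0ℚ ≤ c k) → sumSquares n c ≤ sumBelow n c * sumBelow n c
sumSquares≤sum*sum zero c c≥0 = ≤-reflexive (solve 0 (con 0ℚ := con 0ℚ :* con 0ℚ) refl)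
sumSquares≤sum*sum (suc n) c c≥0 = begin
  sumSquares n c + c n * c n                ≤⟨ +-monoˡ-≤ (c n * c n) (sumSquares≤sum*sum n c c≥0) ⟩
  S * S + c n * c n                         ≡⟨ cong (_+ c n * c n) (sym (+-identityʳ (S * S))) ⟩
  S * S + 0ℚ + c n * c n                    ≤⟨ +-monoˡ-≤ (c n * c n) (+-monoʳ-≤ (S * S) (+-mono-≤ S*cn≥0 S*cn≥0)) ⟩
  S * S + (S * c n + S * c n) + c n * c n
    ≡⟨ solve 2 (λ s a → s :* s :+ (s :* a :+ s :* a) :+ a :* a := (s :+ a) :* (s :+ a)) refl S (c n) ⟩
  (S + c n) * (S + c n)                     ∎
  where
  open ≤-Reasoning
  S = sumBelow n c
  S*cn≥0 : 0ℚ ≤ S * c n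
  S*cn≥0 = nonNegative⁻¹ _ {{nonNeg*nonNeg⇒nonNeg S {{nonNegative (sumBelow-nonNeg n c c≥0)}} (c n) {{nonNegative (c≥0 n)}}}}

hypFib-nonNeg : ∀ r k → 0ℚ ≤ hypFib r k
hypFib-nonNeg zero    zero    = ≤-refl
hypFib-nonNeg zero    (suc k) = nonNegative⁻¹ _ {{normalize-nonNeg 1 (fib (suc k)) {{fib-suc-nonZero k}}}}
hypFib-nonNeg (suc r) zero    = ≤-refl
hypFib-nonNeg (suc r) (suc k) = +-mono-≤ (hypFib-nonNeg (suc r) k) (hypFib-nonNeg r (suc k))

hypFib-zero : ∀ r → hypFib r 0 ≡ 0ℚ
hypFib-zero zero    = refl
hypFib-zero (suc r) = refl

hypFib-suc≡sumBelow : ∀ r m → hypFib (suc r) m ≡ sumBelow (suc m) (hypFib r)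
hypFib-suc≡sumBelow r zero    = sym (trans (+-identityˡ (hypFib r 0)) (hypFib-zero r))
hypFib-suc≡sumBelow r (suc m) = cong (_+ hypFib r (suc m)) (hypFib-suc≡sumBelow r m)

mainTheorem16 : (m r : ℕ) →
    (hypFib (suc r) m * hypFib (suc r) m ≤ frobNormSq (suc m) (circ (suc m) (hypFib r)))
    × (frobNormSq (suc m) (circ (suc m) (hypFib r)) ≤ ℕtoℚ (suc m) * (hypFib (suc r) m * hypFib (suc r) m))
mainTheorem16 m r = lower , upper
  where
  open ≤-Reasoning
  n = suc m
  c = hypFib r
  H = hypFib (suc r) m
  H≡S = hypFib-suc≡sumBelow r m

  lower : H * H ≤ frobNormSq n (circ n c)
  lower = begin
    H * H                            ≡⟨ cong₂ _*_ H≡S H≡S ⟩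
    sumBelow n c * sumBelow n c      ≤⟨ cauchy-schwarz n c ⟩
    ℕtoℚ n * sumSquares n c          ≡⟨ sym (frobNormSq-circ n c) ⟩
    frobNormSq n (circ n c)          ∎

  upper : frobNormSq n (circ n c) ≤ ℕtoℚ n * (H * H)
  upper = begin
    frobNormSq n (circ n c)                   ≡⟨ frobNormSq-circ n c ⟩
    ℕtoℚ n * sumSquares n c                   ≤⟨ *-monoˡ-≤-nonNeg (ℕtoℚ n) {{normalize-nonNeg n 1}} (sumSquares≤sum*sum n c (hypFib-nonNeg r)) ⟩
    ℕtoℚ n * (sumBelow n c * sumBelow n c)    ≡⟨ cong (λ s → ℕtoℚ n * (s * s)) (sym H≡S) ⟩
    ℕtoℚ n * (H * H)                          ∎
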